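{- For every $n\ge1$ and $k\in\{0,1,2\}$, $$\sum_{i=1}^n(1+\beta x_i)^k\prod_{j\ne i}\frac{x_i\oplus x_j}{x_i\ominus x_j}=\begin{cases}\prod_{i=1}^n(1+\beta x_i)^k-\prod_{i=1}^n(1+\beta x_i)&\text{if }n\text{ is even},\\ \prod_{i=1}^n(1+\beta x_i)^k&\text{if }n\text{ is odd}.\end{cases}$$
   Context: $\beta$ is an indeterminate; $x\oplus y=x+y+\beta xy$ and $x\ominus y=(x-y)/(1+\beta y)$; the identity is one of rational functions in $x_1,\dots,x_n$. -}

module Defs where

open import Data.Nat using (ℕ; zero; suc)
open import Data.Fin using (Fin; zero; suc)
import Data.Fin as Fin
open import Data.Rational using (ℚ; 0ℚ; 1ℚ; _+_; _-_; _*_; 1/_; ≢-nonZero)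
open import Data.Rational.Properties using (_≟_)
open import Relation.Nullary using (Dec; yes; no)
open import Relation.Binary.PropositionalEquality using (_≡_)

-- total inverse on ℚ (inverse of 0 is set to 0; only used at nonzero arguments
-- under the hypotheses of the statement)
inv : ℚ → ℚ
inv p with p ≟ 0ℚ
... | yes _ = 0ℚ
... | no p≢0 = 1/_ p {{≢-nonZero p≢0}}

pow : ℚ → ℕ → ℚ
pow x zero    = 1ℚ
pow x (suc k) = x * pow x k

sumF : ∀ {n} → (Fin n → ℚ) → ℚ
sumF {zero}  f = 0ℚ
sumF {suc n} f = f zero + sumF (λ i → f (suc i))

prodF : ∀ {n} → (Fin n → ℚ) → ℚ
prodF {zero}  f = 1ℚ
prodF {suc n} f = f zero * prodF (λ i → f (suc i))

prodExcept : ∀ {n} → Fin n → (Fin n → ℚ) → ℚ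
prodExcept i f = prodF (λ j → factor j (i Fin.≟ j))
  where
  factor : ∀ j → Dec (i ≡ j) → ℚ
  factor j (yes _) = 1ℚ
  factor j (no _)  = f j

module Beta (β : ℚ) where

  _⊕_ : ℚ → ℚ → ℚ
  x ⊕ y = x + y + β * x * y

  _⊖_ : ℚ → ℚ → ℚ
  x ⊖ y = (x - y) * inv (1ℚ + β * y)

{-# OPTIONS --safe #-}
-- Write u a = 1 + β a.  Since (a ⊕ b)(1 + β b) = (a − b) + (b ⊕ b) u a, each factor
-- (xᵢ ⊕ xⱼ)/(xᵢ ⊖ xⱼ) equals 1 + (xⱼ ⊕ xⱼ) u xᵢ/(xᵢ − xⱼ).  Splitting off x₀ therefore expresses
-- lhs k x through lhs k (tail x), the product ∏ⱼ (x₀ ⊕ xⱼ)/(x₀ ⊖ xⱼ) and the sum lhs÷ (k + 1) (tail x) x₀,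
-- whose terms carry an extra factor 1/(xᵢ − x₀); by u xᵢ = u a + β (xᵢ − a), the sums lhs÷ k x a
-- reduce to lhs÷ 1 x a and lhs.  Everything then rests on the identity, for a not among the xᵢ,
--   (a ⊕ a) · lhs÷ 1 x a + ∏ⱼ (a ⊕ xⱼ)/(a ⊖ xⱼ) = ∏ᵢ u xᵢ · (1 if n is even, −u a if n is odd),
-- proved by the same induction: splitting off x₀ with the partial fraction
-- 1/((xᵢ − x₀)(xᵢ − a)) = (1/(xᵢ − x₀) − 1/(xᵢ − a))/(x₀ − a) expresses its left side through the
-- identity for tail x at the two points a and x₀.
module Submission where

open import Defs
open import Algebra.Bundles using (CommutativeRing)
open import Data.Fin using (Fin; zero; suc)
open import Data.Fin.Properties using (suc-injective) renaming (_≟_ to _≟ᶠ_)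
open import Data.Nat using (ℕ; zero; suc; _≤_; _%_; z≤n; s≤s; parity)
open import Data.Parity.Base using (Parity; 0ℙ; 1ℙ; _⁻¹)
open import Data.Parity.Properties using (suc-homo-⁻¹; ⁻¹-selfInverse)
open import Data.Product using (_×_; _,_; proj₁)
open import Data.Rational using (ℚ; 0ℚ; 1ℚ; _+_; _-_; _*_; -_; ≢-nonZero)
import Data.Rational.Properties as ℚ
open import Data.Vec.Functional using (tail)
open import Function using (_∘_)
open import Level using (0ℓ)
open import Relation.Binary.PropositionalEquality
  using (_≡_; _≢_; refl; sym; trans; cong; cong₂; module ≡-Reasoning)
open import Relation.Nullary using (yes; no; contradiction)
open import Relation.Nullary.Decidable using (dec⇒maybe)
open import Tactic.RingSolver using (solve-∀)
open import Tactic.RingSolver.Core.AlmostCommutativeRing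
  using (AlmostCommutativeRing; fromCommutativeRing)
import Algebra.Properties.Group ℚ.+-0-group as AdditiveGroup
import Algebra.Properties.Semiring.Sum (CommutativeRing.semiring ℚ.+-*-commutativeRing) as Sum
import Algebra.Properties.CommutativeMonoid.Sum ℚ.*-1-commutativeMonoid as Product

open ≡-Reasoning

ℚ-ring : AlmostCommutativeRing 0ℓ 0ℓ
ℚ-ring = fromCommutativeRing ℚ.+-*-commutativeRing (λ p → dec⇒maybe (0ℚ ℚ.≟ p))

*-inv : ∀ {d} → d ≢ 0ℚ → d * inv d ≡ 1ℚ
*-inv {d} d≢0 with d ℚ.≟ 0ℚ
... | yes d≡0  = contradiction d≡0 d≢0
... | no  d≢0′ = ℚ.*-inverseʳ d {{≢-nonZero d≢0′}}

inv-unique : ∀ {d e} → d * e ≡ 1ℚ → inv d ≡ e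
inv-unique {d} {e} de≡1 = begin
  inv d             ≡⟨ sym (ℚ.*-identityʳ (inv d)) ⟩
  inv d * 1ℚ        ≡⟨ cong (inv d *_) (sym de≡1) ⟩
  inv d * (d * e)   ≡⟨ sym (ℚ.*-assoc (inv d) d e) ⟩
  inv d * d * e     ≡⟨ cong (_* e) (trans (ℚ.*-comm (inv d) d) (*-inv d≢0)) ⟩
  1ℚ * e            ≡⟨ ℚ.*-identityˡ e ⟩
  e                 ∎
  where
  d≢0 : d ≢ 0ℚ
  d≢0 d≡0 = ℚ.1≢0 (trans (sym de≡1) (trans (cong (_* e) d≡0) (ℚ.*-zeroˡ e)))

x-y≢0 : ∀ {x y} → x ≢ y → x - y ≢ 0ℚ
x-y≢0 x≢y = x≢y ∘ AdditiveGroup.x∙y⁻¹≈ε⇒x≈y _ _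

inv-sub-antisym : ∀ {x y} → x ≢ y → inv (x - y) ≡ - inv (y - x)
inv-sub-antisym {x} {y} x≢y = inv-unique {x - y} (trans (swap x y (inv (y - x))) (*-inv (x-y≢0 (x≢y ∘ sym))))
  where
  swap : ∀ x y v → (x - y) * - v ≡ (y - x) * v
  swap = solve-∀ ℚ-ring

inv-sub-partial : ∀ {x y a} → x ≢ y → x ≢ a → y ≢ a →
                  inv (x - y) * inv (x - a) ≡ inv (y - a) * (inv (x - y) - inv (x - a))
inv-sub-partial {x} {y} {a} x≢y x≢a y≢a = begin
  w₁ * w₂                                          ≡⟨ sym (ℚ.*-identityˡ (w₁ * w₂)) ⟩
  1ℚ * (w₁ * w₂)                                   ≡⟨ cong (_* (w₁ * w₂)) (sym (*-inv (x-y≢0 y≢a))) ⟩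
  (y - a) * w₃ * (w₁ * w₂)                         ≡⟨ regroup x y a w₁ w₂ w₃ ⟩
  w₃ * (w₁ * ((x - a) * w₂) - w₂ * ((x - y) * w₁)) ≡⟨ cong₂ (λ s t → w₃ * (w₁ * s - w₂ * t))
                                                             (*-inv (x-y≢0 x≢a)) (*-inv (x-y≢0 x≢y)) ⟩
  w₃ * (w₁ * 1ℚ - w₂ * 1ℚ)                         ≡⟨ cong₂ (λ s t → w₃ * (s - t))
                                                             (ℚ.*-identityʳ w₁) (ℚ.*-identityʳ w₂) ⟩
  w₃ * (w₁ - w₂)                                   ∎
  where
  w₁ w₂ w₃ : ℚ
  w₁ = inv (x - y)
  w₂ = inv (x - a)
  w₃ = inv (y - a)
  regroup : ∀ x y a w₁ w₂ w₃ → (y - a) * w₃ * (w₁ * w₂) ≡ w₃ * (w₁ * ((x - a) * w₂) - w₂ * ((x - y) * w₁))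
  regroup = solve-∀ ℚ-ring

≡-modulo : ∀ {d} → d ≢ 0ℚ → ∀ {X Y} c → X ≡ Y + c * (d * inv d - 1ℚ) → X ≡ Y
≡-modulo {d} d≢0 {X} {Y} c X≡ = begin
  X                         ≡⟨ X≡ ⟩
  Y + c * (d * inv d - 1ℚ)  ≡⟨ cong (λ z → Y + c * (z - 1ℚ)) (*-inv d≢0) ⟩
  Y + c * (1ℚ - 1ℚ)         ≡⟨ vanish Y c ⟩
  Y                         ∎
  where
  vanish : ∀ Y c → Y + c * (1ℚ - 1ℚ) ≡ Y
  vanish = solve-∀ ℚ-ring

sumF≡sum : ∀ {n} (f : Fin n → ℚ) → sumF f ≡ Sum.sum f
sumF≡sum {zero}  f = refl
sumF≡sum {suc n} f = cong (f zero +_) (sumF≡sum (tail f))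

prodF≡product : ∀ {n} (f : Fin n → ℚ) → prodF f ≡ Product.sum f
prodF≡product {zero}  f = refl
prodF≡product {suc n} f = cong (f zero *_) (prodF≡product (tail f))

sumF-cong : ∀ {n} {f g : Fin n → ℚ} → (∀ i → f i ≡ g i) → sumF f ≡ sumF g
sumF-cong {f = f} {g} f≗g = trans (sumF≡sum f) (trans (Sum.sum-cong-≗ f≗g) (sym (sumF≡sum g)))

sumF-+ : ∀ {n} (f g : Fin n → ℚ) → sumF (λ i → f i + g i) ≡ sumF f + sumF g
sumF-+ f g = begin
  sumF (λ i → f i + g i)     ≡⟨ sumF≡sum (λ i → f i + g i) ⟩
  Sum.sum (λ i → f i + g i)  ≡⟨ Sum.∑-distrib-+ f g ⟩
  Sum.sum f + Sum.sum g      ≡⟨ sym (cong₂ _+_ (sumF≡sum f) (sumF≡sum g)) ⟩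
  sumF f + sumF g            ∎

sumF-*ˡ : ∀ {n} c (f : Fin n → ℚ) → sumF (λ i → c * f i) ≡ c * sumF f
sumF-*ˡ c f = begin
  sumF (λ i → c * f i)     ≡⟨ sumF≡sum (λ i → c * f i) ⟩
  Sum.sum (λ i → c * f i)  ≡⟨ sym (Sum.*-distribˡ-sum c f) ⟩
  c * Sum.sum f            ≡⟨ cong (c *_) (sym (sumF≡sum f)) ⟩
  c * sumF f               ∎

sumF-neg : ∀ {n} (f : Fin n → ℚ) → sumF (λ i → - f i) ≡ - sumF f
sumF-neg {zero}  f = refl
sumF-neg {suc n} f = trans (cong (- f zero +_) (sumF-neg (tail f)))
                           (sym (ℚ.neg-distrib-+ (f zero) (sumF (tail f))))

sumF-- : ∀ {n} (f g : Fin n → ℚ) → sumF (λ i → f i - g i) ≡ sumF f - sumF g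
sumF-- f g = trans (sumF-+ f (λ i → - g i)) (cong (sumF f +_) (sumF-neg g))

prodF-cong : ∀ {n} {f g : Fin n → ℚ} → (∀ i → f i ≡ g i) → prodF f ≡ prodF g
prodF-cong {f = f} {g} f≗g =
  trans (prodF≡product f) (trans (Product.sum-cong-≗ f≗g) (sym (prodF≡product g)))

prodF-* : ∀ {n} (f g : Fin n → ℚ) → prodF (λ i → f i * g i) ≡ prodF f * prodF g
prodF-* f g = begin
  prodF (λ i → f i * g i)         ≡⟨ prodF≡product (λ i → f i * g i) ⟩
  Product.sum (λ i → f i * g i)   ≡⟨ Product.∑-distrib-+ f g ⟩
  Product.sum f * Product.sum g   ≡⟨ sym (cong₂ _*_ (prodF≡product f) (prodF≡product g)) ⟩
  prodF f * prodF g               ∎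

prodF-pow : ∀ {n} (f : Fin n → ℚ) k → prodF (λ i → pow (f i) k) ≡ pow (prodF f) k
prodF-pow {n} f zero    = trans (prodF≡product {n} (λ _ → 1ℚ)) (Product.sum-replicate-zero n)
prodF-pow     f (suc k) = trans (prodF-* f (λ i → pow (f i) k)) (cong (prodF f *_) (prodF-pow f k))

-- The factors of prodExcept are bound locally in Defs; this names them, with
-- prodExcept i f ≡ prodF (exceptFactors i f) holding by refl.
exceptFactors : ∀ {n} → Fin n → (Fin n → ℚ) → Fin n → ℚ
exceptFactors i f = proj₁ {B = λ g → prodExcept i f ≡ prodF g} (_ , refl)

exceptFactors-suc : ∀ {n} (i j : Fin n) (f : Fin (suc n) → ℚ) →
                    exceptFactors (suc i) f (suc j) ≡ exceptFactors i (tail f) j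
exceptFactors-suc i j f with i ≟ᶠ j
... | yes _ = refl
... | no _  = refl

prodExcept-zero : ∀ {n} (f : Fin (suc n) → ℚ) → prodExcept zero f ≡ prodF (tail f)
prodExcept-zero f = ℚ.*-identityˡ (prodF (tail f))

prodExcept-suc : ∀ {n} (i : Fin n) (f : Fin (suc n) → ℚ) →
                 prodExcept (suc i) f ≡ f zero * prodExcept i (tail f)
prodExcept-suc i f = cong (f zero *_) (prodF-cong (λ j → exceptFactors-suc i j f))

Distinct : ∀ {n} → (Fin n → ℚ) → Set
Distinct x = ∀ i j → i ≢ j → x i ≢ x j

_∉_ : ℚ → ∀ {n} → (Fin n → ℚ) → Set
a ∉ x = ∀ i → x i ≢ a

Distinct-tail : ∀ {n} {x : Fin (suc n) → ℚ} → Distinct x → Distinct (tail x)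
Distinct-tail distinct i j i≢j = distinct (suc i) (suc j) (i≢j ∘ suc-injective)

Distinct-head : ∀ {n} {x : Fin (suc n) → ℚ} → Distinct x → x zero ∉ tail x
Distinct-head distinct i = distinct (suc i) zero λ ()

parity-suc : ∀ n → parity n ⁻¹ ≡ parity (suc n)
parity-suc n = ⁻¹-selfInverse (suc-homo-⁻¹ n)

%2≡0⇒parity≡0ℙ : ∀ n → n % 2 ≡ 0 → parity n ≡ 0ℙ
%2≡0⇒parity≡0ℙ zero          _ = refl
%2≡0⇒parity≡0ℙ (suc zero)    ()
%2≡0⇒parity≡0ℙ (suc (suc n)) = %2≡0⇒parity≡0ℙ n

%2≡1⇒parity≡1ℙ : ∀ n → n % 2 ≡ 1 → parity n ≡ 1ℙ
%2≡1⇒parity≡1ℙ zero          ()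
%2≡1⇒parity≡1ℙ (suc zero)    _ = refl
%2≡1⇒parity≡1ℙ (suc (suc n)) = %2≡1⇒parity≡1ℙ n

module _ (β : ℚ) where
  open Beta β

  u : ℚ → ℚ
  u a = 1ℚ + β * a

  NonVanishing : ∀ {n} → (Fin n → ℚ) → Set
  NonVanishing x = ∀ i → u (x i) ≢ 0ℚ

  ratio : ℚ → ℚ → ℚ
  ratio a b = (a ⊕ b) * inv (a ⊖ b)

  coeff : ∀ {n} → (Fin n → ℚ) → Fin n → ℚ
  coeff x i = prodExcept i (λ j → ratio (x i) (x j))

  lhs : ℕ → ∀ {n} → (Fin n → ℚ) → ℚ
  lhs k x = sumF (λ i → pow (u (x i)) k * coeff x i)

  lhs÷ : ℕ → ∀ {n} → (Fin n → ℚ) → ℚ → ℚ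
  lhs÷ k x a = sumF (λ i → pow (u (x i)) k * coeff x i * inv (x i - a))

  prodU : ∀ {n} → (Fin n → ℚ) → ℚ
  prodU x = prodF (λ i → u (x i))

  ratioProd : ∀ {n} → (Fin n → ℚ) → ℚ → ℚ
  ratioProd x a = prodF (λ j → ratio a (x j))

  ε : Parity → ℚ → ℚ
  ε 0ℙ a = 1ℚ
  ε 1ℙ a = - u a

  rhs : Parity → ℚ → ℚ → ℚ
  rhs 0ℙ A B = A - B
  rhs 1ℙ A B = A

  inv-⊖ : ∀ {a b} → a ≢ b → u b ≢ 0ℚ → inv (a ⊖ b) ≡ u b * inv (a - b)
  inv-⊖ {a} {b} a≢b ub≢0 = inv-unique {a ⊖ b} (begin
    (a - b) * inv (u b) * (u b * inv (a - b))    ≡⟨ regroup (a - b) (inv (u b)) (u b) (inv (a - b)) ⟩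
    ((a - b) * inv (a - b)) * (u b * inv (u b))  ≡⟨ cong₂ _*_ (*-inv (x-y≢0 a≢b)) (*-inv ub≢0) ⟩
    1ℚ * 1ℚ                                      ≡⟨ ℚ.*-identityˡ 1ℚ ⟩
    1ℚ                                           ∎)
    where
    regroup : ∀ d v e w → d * v * (e * w) ≡ (d * w) * (e * v)
    regroup = solve-∀ ℚ-ring

  ratio-expand : ∀ {a b} → a ≢ b → u b ≢ 0ℚ → ratio a b ≡ 1ℚ + (b ⊕ b) * u a * inv (a - b)
  ratio-expand {a} {b} a≢b ub≢0 =
    trans (cong ((a ⊕ b) *_) (inv-⊖ a≢b ub≢0))
          (≡-modulo (x-y≢0 a≢b) 1ℚ (numerator β a b (inv (a - b))))
    where
    numerator : ∀ β a b w → (a + b + β * a * b) * ((1ℚ + β * b) * w)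
                          ≡ 1ℚ + (b + b + β * b * b) * (1ℚ + β * a) * w + 1ℚ * ((a - b) * w - 1ℚ)
    numerator = solve-∀ ℚ-ring

  u-shift : ∀ {x a} → x ≢ a → u x * inv (x - a) ≡ u a * inv (x - a) + β
  u-shift {x} {a} x≢a = ≡-modulo (x-y≢0 x≢a) β (shift β x a (inv (x - a)))
    where
    shift : ∀ β x a w → (1ℚ + β * x) * w ≡ (1ℚ + β * a) * w + β + β * ((x - a) * w - 1ℚ)
    shift = solve-∀ ℚ-ring

  coeff-zero : ∀ {n} (x : Fin (suc n) → ℚ) → coeff x zero ≡ ratioProd (tail x) (x zero)
  coeff-zero x = prodExcept-zero (λ j → ratio (x zero) (x j))

  coeff-suc : ∀ {n} (x : Fin (suc n) → ℚ) → u (x zero) ≢ 0ℚ → x zero ∉ tail x → ∀ i →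
              coeff x (suc i)
                ≡ (1ℚ + (x zero ⊕ x zero) * u (x (suc i)) * inv (x (suc i) - x zero)) * coeff (tail x) i
  coeff-suc x u₀≢0 x₀∉ i =
    trans (prodExcept-suc i (λ j → ratio (x (suc i)) (x j)))
          (cong (_* coeff (tail x) i) (ratio-expand (x₀∉ i) u₀≢0))

  lhs-split : ∀ {n} k (x : Fin (suc n) → ℚ) → u (x zero) ≢ 0ℚ → x zero ∉ tail x →
              lhs k x ≡ pow (u (x zero)) k * ratioProd (tail x) (x zero)
                        + (lhs k (tail x) + (x zero ⊕ x zero) * lhs÷ (suc k) (tail x) (x zero))
  lhs-split {n} k x u₀≢0 x₀∉ = cong₂ _+_ (cong (pow (u (x zero)) k *_) (coeff-zero x)) (begin
    sumF (λ i → pow (u (x (suc i))) k * coeff x (suc i))  ≡⟨ sumF-cong term ⟩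
    sumF (λ i → f i + q * g i)                            ≡⟨ sumF-+ f (λ i → q * g i) ⟩
    sumF f + sumF (λ i → q * g i)                         ≡⟨ cong (sumF f +_) (sumF-*ˡ q g) ⟩
    sumF f + q * sumF g                                   ∎)
    where
    q : ℚ
    q = x zero ⊕ x zero
    f g : Fin n → ℚ
    f i = pow (u (x (suc i))) k * coeff (tail x) i
    g i = pow (u (x (suc i))) (suc k) * coeff (tail x) i * inv (x (suc i) - x zero)
    expand : ∀ p q uᵢ w t → p * ((1ℚ + q * uᵢ * w) * t) ≡ p * t + q * (uᵢ * p * t * w)
    expand = solve-∀ ℚ-ring
    term : ∀ i → pow (u (x (suc i))) k * coeff x (suc i) ≡ f i + q * g i
    term i = trans (cong (p *_) (coeff-suc x u₀≢0 x₀∉ i)) (expand p q uᵢ w t)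
      where
      uᵢ p w t : ℚ
      uᵢ = u (x (suc i))
      p = pow uᵢ k
      w = inv (x (suc i) - x zero)
      t = coeff (tail x) i

  lhs÷-suc : ∀ {n} k (x : Fin n → ℚ) {a} → a ∉ x → lhs÷ (suc k) x a ≡ u a * lhs÷ k x a + β * lhs k x
  lhs÷-suc {n} k x {a} a∉ = begin
    lhs÷ (suc k) x a                              ≡⟨ sumF-cong term ⟩
    sumF (λ i → u a * f i + β * g i)              ≡⟨ sumF-+ (λ i → u a * f i) (λ i → β * g i) ⟩
    sumF (λ i → u a * f i) + sumF (λ i → β * g i) ≡⟨ cong₂ _+_ (sumF-*ˡ (u a) f) (sumF-*ˡ β g) ⟩
    u a * sumF f + β * sumF g                     ∎
    where
    f g : Fin n → ℚ
    f i = pow (u (x i)) k * coeff x i * inv (x i - a)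
    g i = pow (u (x i)) k * coeff x i
    pull : ∀ uᵢ p t w → uᵢ * p * t * w ≡ p * t * (uᵢ * w)
    pull = solve-∀ ℚ-ring
    push : ∀ uₐ p t w β → p * t * (uₐ * w + β) ≡ uₐ * (p * t * w) + β * (p * t)
    push = solve-∀ ℚ-ring
    term : ∀ i → pow (u (x i)) (suc k) * coeff x i * inv (x i - a) ≡ u a * f i + β * g i
    term i = begin
      u (x i) * p * t * w  ≡⟨ pull (u (x i)) p t w ⟩
      p * t * (u (x i) * w) ≡⟨ cong (p * t *_) (u-shift (a∉ i)) ⟩
      p * t * (u a * w + β) ≡⟨ push (u a) p t w β ⟩
      u a * f i + β * g i   ∎
      where
      p t w : ℚ
      p = pow (u (x i)) k
      t = coeff x i
      w = inv (x i - a)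

  lhs÷-split : ∀ {n} k (x : Fin (suc n) → ℚ) → u (x zero) ≢ 0ℚ → x zero ∉ tail x → ∀ {a} → a ∉ x →
               lhs÷ k x a
                 ≡ pow (u (x zero)) k * ratioProd (tail x) (x zero) * inv (x zero - a)
                   + (lhs÷ k (tail x) a + ((x zero ⊕ x zero) * inv (x zero - a))
                                          * (lhs÷ (suc k) (tail x) (x zero) - lhs÷ (suc k) (tail x) a))
  lhs÷-split {n} k x u₀≢0 x₀∉ {a} a∉ =
    cong₂ _+_ (cong (λ t → pow (u (x zero)) k * t * inv (x zero - a)) (coeff-zero x)) (begin
      sumF (λ i → pow (u (x (suc i))) k * coeff x (suc i) * inv (x (suc i) - a))
        ≡⟨ sumF-cong term ⟩
      sumF (λ i → f i + c * (g i - h i))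
        ≡⟨ sumF-+ f (λ i → c * (g i - h i)) ⟩
      sumF f + sumF (λ i → c * (g i - h i))
        ≡⟨ cong (sumF f +_) (trans (sumF-*ˡ c (λ i → g i - h i)) (cong (c *_) (sumF-- g h))) ⟩
      sumF f + c * (sumF g - sumF h)
        ∎)
    where
    q c : ℚ
    q = x zero ⊕ x zero
    c = q * inv (x zero - a)
    f g h : Fin n → ℚ
    f i = pow (u (x (suc i))) k * coeff (tail x) i * inv (x (suc i) - a)
    g i = pow (u (x (suc i))) (suc k) * coeff (tail x) i * inv (x (suc i) - x zero)
    h i = pow (u (x (suc i))) (suc k) * coeff (tail x) i * inv (x (suc i) - a)
    expand : ∀ p q uᵢ t w₀ wₐ → p * ((1ℚ + q * uᵢ * w₀) * t) * wₐ ≡ p * t * wₐ + q * (uᵢ * p * t) * (w₀ * wₐ)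
    expand = solve-∀ ℚ-ring
    regroup : ∀ p q uᵢ t w₀ wₐ w → p * t * wₐ + q * (uᵢ * p * t) * (w * (w₀ - wₐ))
                                 ≡ p * t * wₐ + q * w * (uᵢ * p * t * w₀ - uᵢ * p * t * wₐ)
    regroup = solve-∀ ℚ-ring
    term : ∀ i → pow (u (x (suc i))) k * coeff x (suc i) * inv (x (suc i) - a) ≡ f i + c * (g i - h i)
    term i = begin
      p * coeff x (suc i) * wₐ                   ≡⟨ cong (λ t′ → p * t′ * wₐ) (coeff-suc x u₀≢0 x₀∉ i) ⟩
      p * ((1ℚ + q * uᵢ * w₀) * t) * wₐ          ≡⟨ expand p q uᵢ t w₀ wₐ ⟩
      p * t * wₐ + q * (uᵢ * p * t) * (w₀ * wₐ)  ≡⟨ cong (λ z → p * t * wₐ + q * (uᵢ * p * t) * z)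
                                                       (inv-sub-partial (x₀∉ i) (a∉ (suc i)) (a∉ zero)) ⟩
      p * t * wₐ + q * (uᵢ * p * t) * (w * (w₀ - wₐ)) ≡⟨ regroup p q uᵢ t w₀ wₐ w ⟩
      f i + c * (g i - h i)                      ∎
      where
      uᵢ p t w₀ wₐ w : ℚ
      uᵢ = u (x (suc i))
      p = pow uᵢ k
      t = coeff (tail x) i
      w₀ = inv (x (suc i) - x zero)
      wₐ = inv (x (suc i) - a)
      w = inv (x zero - a)

  residue-split : ∀ {n} (x : Fin (suc n) → ℚ) → u (x zero) ≢ 0ℚ → x zero ∉ tail x → ∀ {a} → a ∉ x →
                  (a ⊕ a) * lhs÷ 1 x a + ratioProd x a
                    ≡ ((a ⊕ a) * lhs÷ 1 (tail x) a + ratioProd (tail x) a)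
                        * (1ℚ - (x zero ⊕ x zero) * u a * inv (x zero - a))
                      + ((x zero ⊕ x zero) * lhs÷ 1 (tail x) (x zero) + ratioProd (tail x) (x zero))
                        * ((a ⊕ a) * u (x zero) * inv (x zero - a))
  residue-split {n} x u₀≢0 x₀∉ {a} a∉ = begin
    qₐ * lhs÷ 1 x a + ratio a x₀ * Hₐ
      ≡⟨ cong₂ (λ J r → qₐ * J + r * Hₐ) (lhs÷-split 1 x u₀≢0 x₀∉ a∉) (ratio-expand a≢x₀ u₀≢0) ⟩
    qₐ * (u₀ * 1ℚ * H₀ * w + (Jₐ + q₀ * w * (lhs÷ 2 xs x₀ - lhs÷ 2 xs a))) + (1ℚ + q₀ * uₐ * inv (a - x₀)) * Hₐ
      ≡⟨ cong₂ (λ K₀ Kₐ → qₐ * (u₀ * 1ℚ * H₀ * w + (Jₐ + q₀ * w * (K₀ - Kₐ))) + (1ℚ + q₀ * uₐ * inv (a - x₀)) * Hₐ)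
               (lhs÷-suc 1 xs x₀∉) (lhs÷-suc 1 xs (a∉ ∘ suc)) ⟩
    qₐ * (u₀ * 1ℚ * H₀ * w + (Jₐ + q₀ * w * ((u₀ * J₀ + β * S) - (uₐ * Jₐ + β * S)))) + (1ℚ + q₀ * uₐ * inv (a - x₀)) * Hₐ
      ≡⟨ cong (λ v → qₐ * (u₀ * 1ℚ * H₀ * w + (Jₐ + q₀ * w * ((u₀ * J₀ + β * S) - (uₐ * Jₐ + β * S)))) + (1ℚ + q₀ * uₐ * v) * Hₐ)
              (inv-sub-antisym a≢x₀) ⟩
    qₐ * (u₀ * 1ℚ * H₀ * w + (Jₐ + q₀ * w * ((u₀ * J₀ + β * S) - (uₐ * Jₐ + β * S)))) + (1ℚ + q₀ * uₐ * - w) * Hₐ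
      ≡⟨ regroup qₐ q₀ uₐ u₀ w Hₐ H₀ Jₐ J₀ β S ⟩
    (qₐ * Jₐ + Hₐ) * (1ℚ - q₀ * uₐ * w) + (q₀ * J₀ + H₀) * (qₐ * u₀ * w)
      ∎
    where
    xs : Fin n → ℚ
    xs = tail x
    x₀ qₐ q₀ uₐ u₀ w Hₐ H₀ Jₐ J₀ S : ℚ
    x₀ = x zero
    qₐ = a ⊕ a
    q₀ = x₀ ⊕ x₀
    uₐ = u a
    u₀ = u x₀
    w = inv (x₀ - a)
    Hₐ = ratioProd xs a
    H₀ = ratioProd xs x₀
    Jₐ = lhs÷ 1 xs a
    J₀ = lhs÷ 1 xs x₀
    S = lhs 1 xs
    a≢x₀ : a ≢ x₀
    a≢x₀ = a∉ zero ∘ sym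
    regroup : ∀ qₐ q₀ uₐ u₀ w Hₐ H₀ Jₐ J₀ β S →
      qₐ * (u₀ * 1ℚ * H₀ * w + (Jₐ + q₀ * w * ((u₀ * J₀ + β * S) - (uₐ * Jₐ + β * S)))) + (1ℚ + q₀ * uₐ * - w) * Hₐ
        ≡ (qₐ * Jₐ + Hₐ) * (1ℚ - q₀ * uₐ * w) + (q₀ * J₀ + H₀) * (qₐ * u₀ * w)
    regroup = solve-∀ ℚ-ring

  ε-step : ∀ {x₀ a} → x₀ ≢ a → ∀ P p →
           (P * ε p a) * (1ℚ - (x₀ ⊕ x₀) * u a * inv (x₀ - a)) + (P * ε p x₀) * ((a ⊕ a) * u x₀ * inv (x₀ - a))
             ≡ (u x₀ * P) * ε (p ⁻¹) a
  ε-step {x₀} {a} x₀≢a P 0ℙ = ≡-modulo (x-y≢0 x₀≢a) (- (P * (1ℚ + u x₀ * u a))) (even β x₀ a (inv (x₀ - a)) P)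
    where
    even : ∀ β x₀ a w P →
      (P * 1ℚ) * (1ℚ - (x₀ + x₀ + β * x₀ * x₀) * (1ℚ + β * a) * w) + (P * 1ℚ) * ((a + a + β * a * a) * (1ℚ + β * x₀) * w)
        ≡ ((1ℚ + β * x₀) * P) * - (1ℚ + β * a)
          + - (P * (1ℚ + (1ℚ + β * x₀) * (1ℚ + β * a))) * ((x₀ - a) * w - 1ℚ)
    even = solve-∀ ℚ-ring
  ε-step {x₀} {a} x₀≢a P 1ℙ = ≡-modulo (x-y≢0 x₀≢a) (P * (u x₀ + u a)) (odd β x₀ a (inv (x₀ - a)) P)
    where
    odd : ∀ β x₀ a w P →
      (P * - (1ℚ + β * a)) * (1ℚ - (x₀ + x₀ + β * x₀ * x₀) * (1ℚ + β * a) * w)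
      + (P * - (1ℚ + β * x₀)) * ((a + a + β * a * a) * (1ℚ + β * x₀) * w)
        ≡ ((1ℚ + β * x₀) * P) * 1ℚ + P * ((1ℚ + β * x₀) + (1ℚ + β * a)) * ((x₀ - a) * w - 1ℚ)
    odd = solve-∀ ℚ-ring

  residue : ∀ {n} (x : Fin n → ℚ) → NonVanishing x → Distinct x → ∀ {a} → a ∉ x →
            (a ⊕ a) * lhs÷ 1 x a + ratioProd x a ≡ prodU x * ε (parity n) a
  residue {zero}  x _ _ {a} _ = vanish (a ⊕ a)
    where
    vanish : ∀ q → q * 0ℚ + 1ℚ ≡ 1ℚ * 1ℚ
    vanish = solve-∀ ℚ-ring
  residue {suc m} x nonVanishing distinct {a} a∉ = begin
    (a ⊕ a) * lhs÷ 1 x a + ratioProd x a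
      ≡⟨ residue-split x (nonVanishing zero) (Distinct-head distinct) a∉ ⟩
    ((a ⊕ a) * lhs÷ 1 xs a + ratioProd xs a) * (1ℚ - (x₀ ⊕ x₀) * u a * w)
      + ((x₀ ⊕ x₀) * lhs÷ 1 xs x₀ + ratioProd xs x₀) * ((a ⊕ a) * u x₀ * w)
      ≡⟨ cong₂ (λ Rₐ R₀ → Rₐ * (1ℚ - (x₀ ⊕ x₀) * u a * w) + R₀ * ((a ⊕ a) * u x₀ * w))
               (residue xs (nonVanishing ∘ suc) (Distinct-tail distinct) (a∉ ∘ suc))
               (residue xs (nonVanishing ∘ suc) (Distinct-tail distinct) (Distinct-head distinct)) ⟩
    (prodU xs * ε (parity m) a) * (1ℚ - (x₀ ⊕ x₀) * u a * w)
      + (prodU xs * ε (parity m) x₀) * ((a ⊕ a) * u x₀ * w)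
      ≡⟨ ε-step (a∉ zero) (prodU xs) (parity m) ⟩
    prodU x * ε (parity m ⁻¹) a
      ≡⟨ cong (λ p → prodU x * ε p a) (parity-suc m) ⟩
    prodU x * ε (parity (suc m)) a
      ∎
    where
    xs : Fin m → ℚ
    xs = tail x
    x₀ w : ℚ
    x₀ = x zero
    w = inv (x₀ - a)

  increment : ℕ → ∀ {m} → (Fin (suc m) → ℚ) → ℚ
  increment zero    {m} x = prodU (tail x) * ε (parity m) (x zero)
  increment (suc k)     x = u (x zero) * increment k x + (x zero ⊕ x zero) * β * lhs (suc k) (tail x)

  lhs-suc : ∀ {m} k (x : Fin (suc m) → ℚ) → NonVanishing x → Distinct x →
            lhs k x ≡ lhs k (tail x) + increment k x
  lhs-suc {m} k x nonVanishing distinct = begin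
    lhs k x                                                          ≡⟨ lhs-split k x (nonVanishing zero) x₀∉ ⟩
    pow u₀ k * H₀ + (lhs k xs + q₀ * lhs÷ (suc k) xs x₀)            ≡⟨ swap (pow u₀ k * H₀) (lhs k xs) _ ⟩
    lhs k xs + (pow u₀ k * H₀ + q₀ * lhs÷ (suc k) xs x₀)            ≡⟨ cong (lhs k xs +_) (new≡increment k) ⟩
    lhs k xs + increment k x                                         ∎
    where
    xs : Fin m → ℚ
    xs = tail x
    x₀ u₀ q₀ H₀ : ℚ
    x₀ = x zero
    u₀ = u x₀
    q₀ = x₀ ⊕ x₀
    H₀ = ratioProd xs x₀
    x₀∉ : x₀ ∉ xs
    x₀∉ = Distinct-head distinct
    swap : ∀ a b c → a + (b + c) ≡ b + (a + c)
    swap = solve-∀ ℚ-ring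
    new≡increment : ∀ j → pow u₀ j * H₀ + q₀ * lhs÷ (suc j) xs x₀ ≡ increment j x
    new≡increment zero = trans (flip H₀ (q₀ * lhs÷ 1 xs x₀))
                               (residue xs (nonVanishing ∘ suc) (Distinct-tail distinct) x₀∉)
      where
      flip : ∀ H J → 1ℚ * H + J ≡ J + H
      flip = solve-∀ ℚ-ring
    new≡increment (suc j) = begin
      u₀ * pow u₀ j * H₀ + q₀ * lhs÷ (suc (suc j)) xs x₀
        ≡⟨ cong (λ J → u₀ * pow u₀ j * H₀ + q₀ * J) (lhs÷-suc (suc j) xs x₀∉) ⟩
      u₀ * pow u₀ j * H₀ + q₀ * (u₀ * lhs÷ (suc j) xs x₀ + β * lhs (suc j) xs)
        ≡⟨ regroup u₀ (pow u₀ j) H₀ q₀ (lhs÷ (suc j) xs x₀) β (lhs (suc j) xs) ⟩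
      u₀ * (pow u₀ j * H₀ + q₀ * lhs÷ (suc j) xs x₀) + q₀ * β * lhs (suc j) xs
        ≡⟨ cong (λ z → u₀ * z + q₀ * β * lhs (suc j) xs) (new≡increment j) ⟩
      increment (suc j) x
        ∎
      where
      regroup : ∀ u₀ p H₀ q₀ J β S → u₀ * p * H₀ + q₀ * (u₀ * J + β * S) ≡ u₀ * (p * H₀ + q₀ * J) + q₀ * β * S
      regroup = solve-∀ ℚ-ring

  lhs-closed₀ : ∀ {n} (x : Fin n → ℚ) → NonVanishing x → Distinct x → lhs 0 x ≡ rhs (parity n) 1ℚ (prodU x)
  lhs-closed₀ {zero}  x _ _ = refl
  lhs-closed₀ {suc m} x nonVanishing distinct = begin
    lhs 0 x                                ≡⟨ lhs-suc 0 x nonVanishing distinct ⟩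
    lhs 0 xs + P * ε (parity m) x₀         ≡⟨ cong (_+ P * ε (parity m) x₀)
                                                   (lhs-closed₀ xs (nonVanishing ∘ suc) (Distinct-tail distinct)) ⟩
    rhs (parity m) 1ℚ P + P * ε (parity m) x₀ ≡⟨ step (parity m) ⟩
    rhs (parity m ⁻¹) 1ℚ (prodU x)         ≡⟨ cong (λ p → rhs p 1ℚ (prodU x)) (parity-suc m) ⟩
    rhs (parity (suc m)) 1ℚ (prodU x)      ∎
    where
    xs : Fin m → ℚ
    xs = tail x
    x₀ P : ℚ
    x₀ = x zero
    P = prodU xs
    step : ∀ p → rhs p 1ℚ P + P * ε p x₀ ≡ rhs (p ⁻¹) 1ℚ (u x₀ * P)
    step 0ℙ = even P
      where
      even : ∀ P → (1ℚ - P) + P * 1ℚ ≡ 1ℚ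
      even = solve-∀ ℚ-ring
    step 1ℙ = odd β x₀ P
      where
      odd : ∀ β x₀ P → 1ℚ + P * - (1ℚ + β * x₀) ≡ 1ℚ - (1ℚ + β * x₀) * P
      odd = solve-∀ ℚ-ring

  lhs-closed₁ : ∀ {n} (x : Fin n → ℚ) → NonVanishing x → Distinct x →
                lhs 1 x ≡ rhs (parity n) (pow (prodU x) 1) (prodU x)
  lhs-closed₁ {zero}  x _ _ = refl
  lhs-closed₁ {suc m} x nonVanishing distinct = begin
    lhs 1 x
      ≡⟨ lhs-suc 1 x nonVanishing distinct ⟩
    lhs 1 xs + (u₀ * (P * ε (parity m) x₀) + q₀ * β * lhs 1 xs)
      ≡⟨ cong (λ s → s + (u₀ * (P * ε (parity m) x₀) + q₀ * β * s))
              (lhs-closed₁ xs (nonVanishing ∘ suc) (Distinct-tail distinct)) ⟩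
    rhs (parity m) (P * 1ℚ) P + (u₀ * (P * ε (parity m) x₀) + q₀ * β * rhs (parity m) (P * 1ℚ) P)
      ≡⟨ step (parity m) ⟩
    rhs (parity m ⁻¹) (prodU x * 1ℚ) (prodU x)
      ≡⟨ cong (λ p → rhs p (prodU x * 1ℚ) (prodU x)) (parity-suc m) ⟩
    rhs (parity (suc m)) (prodU x * 1ℚ) (prodU x)
      ∎
    where
    xs : Fin m → ℚ
    xs = tail x
    x₀ u₀ q₀ P : ℚ
    x₀ = x zero
    u₀ = u x₀
    q₀ = x₀ ⊕ x₀
    P = prodU xs
    step : ∀ p → rhs p (P * 1ℚ) P + (u₀ * (P * ε p x₀) + q₀ * β * rhs p (P * 1ℚ) P)
                 ≡ rhs (p ⁻¹) (u₀ * P * 1ℚ) (u₀ * P)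
    step 0ℙ = even β x₀ P
      where
      even : ∀ β x₀ P → (P * 1ℚ - P) + ((1ℚ + β * x₀) * (P * 1ℚ) + (x₀ + x₀ + β * x₀ * x₀) * β * (P * 1ℚ - P))
                        ≡ (1ℚ + β * x₀) * P * 1ℚ
      even = solve-∀ ℚ-ring
    step 1ℙ = odd β x₀ P
      where
      odd : ∀ β x₀ P → P * 1ℚ + ((1ℚ + β * x₀) * (P * - (1ℚ + β * x₀)) + (x₀ + x₀ + β * x₀ * x₀) * β * (P * 1ℚ))
                       ≡ (1ℚ + β * x₀) * P * 1ℚ - (1ℚ + β * x₀) * P
      odd = solve-∀ ℚ-ring

  lhs-closed₂ : ∀ {n} (x : Fin n → ℚ) → NonVanishing x → Distinct x →
                lhs 2 x ≡ rhs (parity n) (pow (prodU x) 2) (prodU x)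
  lhs-closed₂ {zero}  x _ _ = refl
  lhs-closed₂ {suc m} x nonVanishing distinct = begin
    lhs 2 x
      ≡⟨ lhs-suc 2 x nonVanishing distinct ⟩
    lhs 2 xs + (u₀ * (u₀ * (P * ε (parity m) x₀) + q₀ * β * lhs 1 xs) + q₀ * β * lhs 2 xs)
      ≡⟨ cong₂ (λ s₁ s₂ → s₂ + (u₀ * (u₀ * (P * ε (parity m) x₀) + q₀ * β * s₁) + q₀ * β * s₂))
               (lhs-closed₁ xs (nonVanishing ∘ suc) (Distinct-tail distinct))
               (lhs-closed₂ xs (nonVanishing ∘ suc) (Distinct-tail distinct)) ⟩
    rhs (parity m) (P * (P * 1ℚ)) P
      + (u₀ * (u₀ * (P * ε (parity m) x₀) + q₀ * β * rhs (parity m) (P * 1ℚ) P)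
         + q₀ * β * rhs (parity m) (P * (P * 1ℚ)) P)
      ≡⟨ step (parity m) ⟩
    rhs (parity m ⁻¹) (prodU x * (prodU x * 1ℚ)) (prodU x)
      ≡⟨ cong (λ p → rhs p (prodU x * (prodU x * 1ℚ)) (prodU x)) (parity-suc m) ⟩
    rhs (parity (suc m)) (prodU x * (prodU x * 1ℚ)) (prodU x)
      ∎
    where
    xs : Fin m → ℚ
    xs = tail x
    x₀ u₀ q₀ P : ℚ
    x₀ = x zero
    u₀ = u x₀
    q₀ = x₀ ⊕ x₀
    P = prodU xs
    step : ∀ p → rhs p (P * (P * 1ℚ)) P
                 + (u₀ * (u₀ * (P * ε p x₀) + q₀ * β * rhs p (P * 1ℚ) P) + q₀ * β * rhs p (P * (P * 1ℚ)) P)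
                 ≡ rhs (p ⁻¹) (u₀ * P * (u₀ * P * 1ℚ)) (u₀ * P)
    step 0ℙ = even β x₀ P
      where
      even : ∀ β x₀ P →
        (P * (P * 1ℚ) - P)
        + ((1ℚ + β * x₀) * ((1ℚ + β * x₀) * (P * 1ℚ) + (x₀ + x₀ + β * x₀ * x₀) * β * (P * 1ℚ - P))
           + (x₀ + x₀ + β * x₀ * x₀) * β * (P * (P * 1ℚ) - P))
          ≡ (1ℚ + β * x₀) * P * ((1ℚ + β * x₀) * P * 1ℚ)
      even = solve-∀ ℚ-ring
    step 1ℙ = odd β x₀ P
      where
      odd : ∀ β x₀ P →
        P * (P * 1ℚ)
        + ((1ℚ + β * x₀) * ((1ℚ + β * x₀) * (P * - (1ℚ + β * x₀)) + (x₀ + x₀ + β * x₀ * x₀) * β * (P * 1ℚ))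
           + (x₀ + x₀ + β * x₀ * x₀) * β * (P * (P * 1ℚ)))
          ≡ (1ℚ + β * x₀) * P * ((1ℚ + β * x₀) * P * 1ℚ) - (1ℚ + β * x₀) * P
      odd = solve-∀ ℚ-ring

  lhs-closed : ∀ {n} (x : Fin n → ℚ) → NonVanishing x → Distinct x → ∀ {k} → k ≤ 2 →
               lhs k x ≡ rhs (parity n) (pow (prodU x) k) (prodU x)
  lhs-closed x nonVanishing distinct z≤n               = lhs-closed₀ x nonVanishing distinct
  lhs-closed x nonVanishing distinct (s≤s z≤n)         = lhs-closed₁ x nonVanishing distinct
  lhs-closed x nonVanishing distinct (s≤s (s≤s z≤n))   = lhs-closed₂ x nonVanishing distinct

lemma2p5 : (β : ℚ) (n : ℕ) → 1 ≤ n → (k : ℕ) → k ≤ 2 → (x : Fin n → ℚ)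
    → (∀ i → 1ℚ + β * x i ≢ 0ℚ)
    → (∀ i j → i ≢ j → x i ≢ x j)
    → let open Beta β
          lhs = sumF (λ i → pow (1ℚ + β * x i) k
                  * prodExcept i (λ j → (x i ⊕ x j) * inv (x i ⊖ x j)))
          A = prodF (λ i → pow (1ℚ + β * x i) k)
          B = prodF (λ i → 1ℚ + β * x i)
      in (n % 2 ≡ 0 → lhs ≡ A - B) × (n % 2 ≡ 1 → lhs ≡ A)
lemma2p5 β n _ k k≤2 x nonVanishing distinct = even , odd
  where
  A : ℚ
  A = prodF (λ i → pow (u β (x i)) k)
  closed : lhs β k x ≡ rhs β (parity n) A (prodU β x)
  closed = trans (lhs-closed β x nonVanishing distinct k≤2)
                 (cong (λ A′ → rhs β (parity n) A′ (prodU β x)) (sym (prodF-pow (λ i → u β (x i)) k)))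
  even : n % 2 ≡ 0 → lhs β k x ≡ A - prodU β x
  even n%2≡0 = trans closed (cong (λ p → rhs β p A (prodU β x)) (%2≡0⇒parity≡0ℙ n n%2≡0))
  odd : n % 2 ≡ 1 → lhs β k x ≡ A
  odd n%2≡1 = trans closed (cong (λ p → rhs β p A (prodU β x)) (%2≡1⇒parity≡1ℙ n n%2≡1))
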